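{- Let $q$ be a propositional variable of the language of propositional modal logic with necessity operator $\Box$ (and $\Diamond = \neg\Box\neg$). Suppose $q$ is "defined" by the premise $$\Box\,(q \leftrightarrow \neg\Box q).$$ Then, in the modal system $\mathbf{T}$ (and hence in any normal modal logic extending $\mathbf{T}$), the formula $q \leftrightarrow \neg q$ is derivable from this premise. Semantically: in every Kripke model whose accessibility relation is reflexive, at every world $w$ at which $\Box(q \leftrightarrow \neg\Box q)$ is true, the formula $q \leftrightarrow \neg q$ is also true.
   Context: Modal system $\mathbf{T}$ is the normal modal logic axiomatized by propositional tautologies, the axiom $\mathrm{K}$: $\Box(p\to r)\to(\Box p\to\Box r)$, the axiom $\mathrm{T}$: $\Box p \to p$, modus ponens and necessitation; it is sound and complete for Kripke models whose accessibility relation is reflexive. In a Kripke model, $\Box\varphi$ is true at $w$ iff $\varphi$ is true at every world accessible from $w$, and $\Diamond\varphi$ is true at $w$ iff $\varphi$ is true at some world accessible from $w$. The premise $\Box(q\leftrightarrow\neg\Box q)$ formalizes the stipulation that $q$ is the proposition "$q$ is not necessary", and is used as a local premise (the derivation is not required to apply necessitation to it). -}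

module Defs where

open import Data.Nat using (ℕ)
open import Data.Bool using (Bool; true; false; not; _∧_; _∨_)
open import Data.Empty using (⊥)
open import Data.List using (List; []; _∷_)
open import Data.List.Membership.Propositional using (_∈_)
open import Relation.Binary.PropositionalEquality using (_≡_)
open import Level using (Level; suc; _⊔_; Lift)

infixr 20 _⇒_

data Form : Set where
  var : ℕ → Form
  ⊥'  : Form
  _⇒_ : Form → Form → Form
  □   : Form → Form

¬' : Form → Form
¬' φ = φ ⇒ ⊥'

_∧'_ : Form → Form → Form
φ ∧' ψ = ¬' (φ ⇒ ¬' ψ)

_⇔_ : Form → Form → Form
φ ⇔ ψ = (φ ⇒ ψ) ∧' (ψ ⇒ φ)

◇ : Form → Form
◇ φ = ¬' (□ (¬' φ))

-- Classical two-valued evaluation, treating variables and boxed formulas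
-- as propositional atoms (assigned by f).
eval : (Form → Bool) → Form → Bool
eval f (var p) = f (var p)
eval f ⊥'      = false
eval f (φ ⇒ ψ) = not (eval f φ) ∨ eval f ψ
eval f (□ φ)   = f (□ φ)

-- Propositional tautology (substitution instances of tautologies in the modal language).
Tautology : Form → Set
Tautology φ = ∀ (f : Form → Bool) → eval f φ ≡ true

-- Derivability in system T from a list of local premises Γ.
-- Necessitation applies only to theorems (derivations without premises).
data _⊢T_ : List Form → Form → Set where
  hyp  : ∀ {Γ φ} → φ ∈ Γ → Γ ⊢T φ
  taut : ∀ {Γ φ} → Tautology φ → Γ ⊢T φ
  axK  : ∀ {Γ φ ψ} → Γ ⊢T (□ (φ ⇒ ψ) ⇒ (□ φ ⇒ □ ψ))
  axT  : ∀ {Γ φ} → Γ ⊢T (□ φ ⇒ φ)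
  mp   : ∀ {Γ φ ψ} → Γ ⊢T (φ ⇒ ψ) → Γ ⊢T φ → Γ ⊢T ψ
  nec  : ∀ {Γ φ} → [] ⊢T φ → Γ ⊢T □ φ

record Model (ℓ : Level) : Set (suc ℓ) where
  field
    W : Set ℓ
    R : W → W → Set ℓ
    V : ℕ → W → Bool

open Model public

_,_⊨_ : ∀ {ℓ} (M : Model ℓ) → W M → Form → Set ℓ
M , w ⊨ var p   = Lift _ (V M p w ≡ true)
M , w ⊨ ⊥'      = Lift _ ⊥
M , w ⊨ (φ ⇒ ψ) = M , w ⊨ φ → M , w ⊨ ψ
M , w ⊨ □ φ     = ∀ v → R M w v → M , v ⊨ φ

Reflexive : ∀ {ℓ} → Model ℓ → Set ℓ
Reflexive M = ∀ w → R M w w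

-- Both halves rest on the same observation: over T the premise is inconsistent.
-- Since □ φ ⇒ φ, the biconditional φ ⇔ ¬□φ propositionally yields φ; by
-- necessitation and K the premise □(φ ⇔ ¬□φ) then yields □φ, and with its T-instance
-- φ ⇔ ¬□φ this is a contradiction, from which q ⇔ ¬q follows ex falso. The Kripke
-- argument is the same at every world accessible from w, read constructively.
module Submission where

open import Defs
open import Data.Nat using (ℕ)
open import Data.List using (List; []; _∷_)
open import Data.Product using (_×_; _,_)
open import Data.Bool using (true; false)
open import Data.Empty using (⊥; ⊥-elim)
open import Data.List.Relation.Unary.Any using (here)
open import Relation.Binary.PropositionalEquality using (refl)
open import Relation.Nullary using (¬_)
import Level
open Level using (Level; lift; lower)

private
  variable
    ℓ : Level
    Γ : List Form
    φ ψ : Form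

¬□-fixpoint : Form → Form
¬□-fixpoint φ = φ ⇔ ¬' (□ φ)

taut-⇔¬-absorb : Tautology ((ψ ⇒ φ) ⇒ (φ ⇔ ¬' ψ) ⇒ φ)
taut-⇔¬-absorb {ψ = ψ} {φ = φ} f with eval f φ | eval f ψ
... | true  | true  = refl
... | true  | false = refl
... | false | true  = refl
... | false | false = refl

taut-⇔¬-contradiction : Tautology ((φ ⇔ ¬' ψ) ⇒ φ ⇒ ψ ⇒ ⊥')
taut-⇔¬-contradiction {φ = φ} {ψ = ψ} f with eval f φ | eval f ψ
... | true  | true  = refl
... | true  | false = refl
... | false | true  = refl
... | false | false = refl

⊢T-□-mono : [] ⊢T (φ ⇒ ψ) → Γ ⊢T □ φ → Γ ⊢T □ ψ
⊢T-□-mono φ⇒ψ □φ = mp (mp axK (nec φ⇒ψ)) □φ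

⊢T-⊥'-elim : Γ ⊢T ⊥' → Γ ⊢T ψ
⊢T-⊥'-elim = mp (taut (λ _ → refl))

⊢T-¬□-fixpoint⇒ : [] ⊢T (¬□-fixpoint φ ⇒ φ)
⊢T-¬□-fixpoint⇒ {φ} = mp (taut (taut-⇔¬-absorb {ψ = □ φ} {φ = φ})) axT

⊢T-□¬□-fixpoint-inconsistent : Γ ⊢T □ (¬□-fixpoint φ) → Γ ⊢T ⊥'
⊢T-□¬□-fixpoint-inconsistent {Γ} {φ} premise =
  mp (mp (mp contradiction (mp axT premise)) (mp axT □φ)) □φ
  where
    contradiction : Γ ⊢T (¬□-fixpoint φ ⇒ φ ⇒ □ φ ⇒ ⊥')
    contradiction = taut (taut-⇔¬-contradiction {φ = φ} {ψ = □ φ})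

    □φ : Γ ⊢T □ φ
    □φ = ⊢T-□-mono (⊢T-¬□-fixpoint⇒ {φ}) premise

-- Valuations are Bool-valued, so every formula is stable; this replaces the
-- classical case split "□φ holds at v or it does not".
⊨-stable : (M : Model ℓ) (w : W M) (φ : Form) → M , w ⊨ ¬' (¬' φ) → M , w ⊨ φ
⊨-stable M w (var p) ¬¬φ with V M p w
... | true  = lift refl
... | false = ⊥-elim (lower (¬¬φ (λ { (lift ()) })))
⊨-stable M w ⊥'      ¬¬φ = ¬¬φ (λ ⊥w → ⊥w)
⊨-stable M w (φ ⇒ ψ) ¬¬φ⇒ψ φw =
  ⊨-stable M w ψ (λ ¬ψw → ¬¬φ⇒ψ (λ φ⇒ψw → ¬ψw (φ⇒ψw φw)))
⊨-stable M w (□ φ)   ¬¬□φ v wRv =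
  ⊨-stable M v φ (λ ¬φv → ¬¬□φ (λ □φw → ¬φv (□φw v wRv)))

⊭-□¬□-fixpoint : (M : Model ℓ) → Reflexive M → ∀ w φ →
                 ¬ (M , w ⊨ □ (¬□-fixpoint φ))
⊭-□¬□-fixpoint M refl-R w φ premise =
  lower (premise w (refl-R w) (λ φ⇒¬□φ _ → φ⇒¬□φ (□φ w (refl-R w)) □φ))
  where
    □φ : M , w ⊨ □ φ
    □φ v wRv = ⊨-stable M v φ (λ ¬φv →
      premise v wRv (λ _ ¬□φ⇒φ → ¬φv (¬□φ⇒φ (λ □φv → ¬φv (□φv v (refl-R v))))))

mainTheorem1 : (q : ℕ) →
    ((□ (var q ⇔ ¬' (□ (var q)))) ∷ []) ⊢T (var q ⇔ ¬' (var q))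
    × (∀ (M : Model Level.zero) → Reflexive M → ∀ w →
    M , w ⊨ □ (var q ⇔ ¬' (□ (var q))) → M , w ⊨ (var q ⇔ ¬' (var q)))
mainTheorem1 q =
    ⊢T-⊥'-elim (⊢T-□¬□-fixpoint-inconsistent (hyp (here refl)))
  , λ M refl-R w premise → ⊥-elim (⊭-□¬□-fixpoint M refl-R w (var q) premise)
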